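{- Let $\mathbf{P}$ be a residuated partially ordered monoid and let $\mathbf{L}$ be a join-completion of $\mathbf{P}$ which is a residuated lattice with respect to a multiplication extending the multiplication of $\mathbf{P}$. Let $d\in P$ be a cyclic dualizing element of $\mathbf{P}$. Put $P_{\gamma_d}=\{(x\backslash_{\mathbf{P}} d)\backslash_{\mathbf{P}} d\mid x\in P\}$ and $L_{\gamma_d}=\{(x\backslash_{\mathbf{L}} d)\backslash_{\mathbf{L}} d\mid x\in L\}$, both with the order induced from $\mathbf{L}$. Then $\mathbf{L}_{\gamma_d}$ is the Dedekind–MacNeille completion of $\mathbf{P}_{\gamma_d}$; that is, $P_{\gamma_d}\subseteq L_{\gamma_d}$, $\mathbf{L}_{\gamma_d}$ is a complete lattice, and every element of $L_{\gamma_d}$ is both a join and a meet in $\mathbf{L}_{\gamma_d}$ of elements of $P_{\gamma_d}$.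
   Context: A residuated partially ordered monoid is a partially ordered monoid (multiplication order-preserving in each argument) in which the residuals $a\backslash b=\max\{x\mid ax\le b\}$ and $b/a=\max\{x\mid xa\le b\}$ always exist. A residuated lattice is a residuated partially ordered monoid whose order is a lattice. A join-completion of $\mathbf{P}$ is a complete lattice $\mathbf{L}$ with $P\subseteq L$, whose order restricts to that of $\mathbf{P}$, in which every element is a join of elements of $P$. An element $d$ of a residuated partially ordered monoid is cyclic if $d/x=x\backslash d$ for all $x$; writing $x\rightsquigarrow d$ for this common value, $d$ is cyclic dualizing if moreover $(x\rightsquigarrow d)\rightsquigarrow d=x$ for all $x$. -}

module Defs where

open import Data.Product using (Σ; Σ-syntax; ∃; ∃-syntax; _×_; _,_)
open import Data.Unit using (⊤)
open import Relation.Binary.PropositionalEquality using (_≡_)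
open import Relation.Binary.Structures using (IsPartialOrder)

Subset : Set → Set₁
Subset A = A → Set

module Order {A : Set} (_≤_ : A → A → Set) where

  IsUpperBound : Subset A → A → Set
  IsUpperBound S u = ∀ x → S x → x ≤ u

  IsLowerBound : Subset A → A → Set
  IsLowerBound S l = ∀ x → S x → l ≤ x

  IsMaxOf : Subset A → A → Set
  IsMaxOf S m = S m × IsUpperBound S m

  IsSupIn : Subset A → Subset A → A → Set
  IsSupIn Q S s = Q s × IsUpperBound S s × (∀ u → Q u → IsUpperBound S u → s ≤ u)

  IsInfIn : Subset A → Subset A → A → Set
  IsInfIn Q S i = Q i × IsLowerBound S i × (∀ l → Q l → IsLowerBound S l → l ≤ i)

  IsCompleteLatticeIn : Subset A → Set₁
  IsCompleteLatticeIn Q =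
    ∀ (S : Subset A) → (∀ x → S x → Q x) →
      (Σ[ s ∈ A ] IsSupIn Q S s) × (Σ[ i ∈ A ] IsInfIn Q S i)

-- A residuated lattice L whose lattice order is complete
-- (every subset has a join ⋁ S; meets then exist as well).
record CompleteResiduatedLattice (L : Set) : Set₁ where
  field
    _≤_            : L → L → Set
    isPartialOrder : IsPartialOrder _≡_ _≤_
    ⋁              : Subset L → L
  open Order _≤_ public
  field
    ⋁-sup          : ∀ S → IsSupIn (λ _ → ⊤) S (⋁ S)
    _·_            : L → L → L
    e              : L
    ·-assoc        : ∀ x y z → ((x · y) · z) ≡ (x · (y · z))
    ·-identityˡ    : ∀ x → (e · x) ≡ x
    ·-identityʳ    : ∀ x → (x · e) ≡ x
    ·-monoˡ        : ∀ {x y} z → x ≤ y → (x · z) ≤ (y · z)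
    ·-monoʳ        : ∀ {x y} z → x ≤ y → (z · x) ≤ (z · y)
    _\\_           : L → L → L
    _//_           : L → L → L
    \\-max         : ∀ a b → IsMaxOf (λ x → (a · x) ≤ b) (a \\ b)
    //-max         : ∀ a b → IsMaxOf (λ x → (x · a) ≤ b) (b // a)

record ResiduatedSubPomonoid {L : Set} (𝐋 : CompleteResiduatedLattice L) : Set₁ where
  open CompleteResiduatedLattice 𝐋
  field
    InP       : Subset L
    e∈P       : InP e
    ·-closed  : ∀ {a b} → InP a → InP b → InP (a · b)
    _\\P_     : L → L → L
    _//P_     : L → L → L
    \\P-max   : ∀ {a b} → InP a → InP b →
                IsMaxOf (λ x → InP x × ((a · x) ≤ b)) (a \\P b)
    //P-max   : ∀ {a b} → InP a → InP b →
                IsMaxOf (λ x → InP x × ((x · a) ≤ b)) (b //P a)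

module _ {L : Set} {𝐋 : CompleteResiduatedLattice L} (𝐏 : ResiduatedSubPomonoid 𝐋) where
  open CompleteResiduatedLattice 𝐋
  open ResiduatedSubPomonoid 𝐏

  IsJoinCompletion : Set₁
  IsJoinCompletion =
    ∀ a → Σ[ S ∈ Subset L ] ((∀ x → S x → InP x) × IsSupIn (λ _ → ⊤) S a)

  IsCyclicDualizing : L → Set
  IsCyclicDualizing d =
    InP d ×
    (∀ x → InP x → (d //P x) ≡ (x \\P d)) ×
    (∀ x → InP x → ((x \\P d) \\P d) ≡ x)

  Pγ : L → Subset L
  Pγ d y = Σ[ x ∈ L ] (InP x × y ≡ ((x \\P d) \\P d))

Lγ : {L : Set} (𝐋 : CompleteResiduatedLattice L) → L → Subset L
Lγ {L} 𝐋 d y = Σ[ x ∈ L ] (y ≡ ((x \\ d) \\ d))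
  where open CompleteResiduatedLattice 𝐋

-- Because L is a join-completion of P, the residuals of P are those of L, and cyclicity of d
-- passes from P to L by writing both factors of a product as joins of elements of P.  In L,
-- x ↦ (x \\ d) \\ d is then a closure operator whose image is the image of x ↦ x \\ d; since
-- (⋁ Z) \\ d is the meet of the z \\ d, that image is closed under meets, hence a complete
-- lattice.  As d is dualizing in P, P_γ is just P, so every element of L_γ is a join of
-- elements of P, and every x \\ d with x = ⋁ R, R ⊆ P, is the meet of the r \\ d ∈ P.
module Submission where

open import Defs
open import Data.Product using (Σ; Σ-syntax; _×_; _,_; proj₁; proj₂)
open import Data.Unit using (⊤; tt)
open import Relation.Binary.PropositionalEquality using (_≡_; refl; sym; trans; cong; subst)
open import Relation.Binary.Structures using (IsPartialOrder)

module _ {A : Set} (_≤_ : A → A → Set) (Q : Subset A) where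
  open Order _≤_

  -- the join of S is the meet of its upper bounds
  IsCompleteLatticeIn-fromInfs :
    (∀ S → (∀ x → S x → Q x) → Σ[ i ∈ A ] IsInfIn Q S i) → IsCompleteLatticeIn Q
  IsCompleteLatticeIn-fromInfs inf S S⊆Q = sup , inf S S⊆Q
    where
      UpperBounds : Subset A
      UpperBounds u = Q u × IsUpperBound S u

      sup : Σ[ s ∈ A ] IsSupIn Q S s
      sup with inf UpperBounds (λ _ → proj₁)
      ... | i , Qi , i-lower , i-greatest =
        i , Qi , (λ x Sx → i-greatest x (S⊆Q x Sx) (λ _ (_ , u-upper) → u-upper x Sx))
          , (λ u Qu u-upper → i-lower u (Qu , u-upper))

module ResiduatedLatticeProperties {L : Set} (𝐋 : CompleteResiduatedLattice L) where
  open CompleteResiduatedLattice 𝐋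
  open IsPartialOrder isPartialOrder public using (antisym) renaming (trans to ≤-trans)

  IsJoin : Subset L → L → Set
  IsJoin = IsSupIn (λ _ → ⊤)

  join-upper : ∀ {S s} → IsJoin S s → IsUpperBound S s
  join-upper (_ , upper , _) = upper

  join-least : ∀ {S s u} → IsJoin S s → IsUpperBound S u → s ≤ u
  join-least {u = u} (_ , _ , least) = least u tt

  ·-mono : ∀ {x y u v} → x ≤ y → u ≤ v → (x · u) ≤ (y · v)
  ·-mono {y = y} {u = u} x≤y u≤v = ≤-trans (·-monoˡ u x≤y) (·-monoʳ y u≤v)

  \\-intro : ∀ {a b x} → (a · x) ≤ b → x ≤ (a \\ b)
  \\-intro {a} {b} {x} = proj₂ (\\-max a b) x

  \\-elim : ∀ {a b x} → x ≤ (a \\ b) → (a · x) ≤ b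
  \\-elim {a} {b} x≤a\\b = ≤-trans (·-monoʳ a x≤a\\b) (proj₁ (\\-max a b))

  //-intro : ∀ {a b x} → (x · a) ≤ b → x ≤ (b // a)
  //-intro {a} {b} {x} = proj₂ (//-max a b) x

  //-elim : ∀ {a b x} → x ≤ (b // a) → (x · a) ≤ b
  //-elim {a} {b} x≤b//a = ≤-trans (·-monoˡ a x≤b//a) (proj₁ (//-max a b))

  \\-antitoneˡ : ∀ {a b c} → a ≤ b → (b \\ c) ≤ (a \\ c)
  \\-antitoneˡ {b = b} {c = c} a≤b = \\-intro (≤-trans (·-monoˡ (b \\ c) a≤b) (proj₁ (\\-max b c)))

  \\-join-greatest : ∀ {Z s c x} → IsJoin Z s → (∀ z → Z z → x ≤ (z \\ c)) → x ≤ (s \\ c)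
  \\-join-greatest s-join x≤z\\c =
    \\-intro (//-elim (join-least s-join (λ z Zz → //-intro (\\-elim (x≤z\\c z Zz)))))

  //-join-greatest : ∀ {Z s c x} → IsJoin Z s → (∀ z → Z z → x ≤ (c // z)) → x ≤ (c // s)
  //-join-greatest s-join x≤c//z =
    //-intro (\\-elim (join-least s-join (λ z Zz → \\-intro (//-elim (x≤c//z z Zz)))))

module CyclicElement {L : Set} (𝐋 : CompleteResiduatedLattice L) (c : L) where
  open CompleteResiduatedLattice 𝐋
  open ResiduatedLatticeProperties 𝐋

  IsCyclic : Set
  IsCyclic = ∀ x y → (x · y) ≤ c → (y · x) ≤ c

  module _ (cyclic : IsCyclic) where

    double-\\-inflationary : ∀ x → x ≤ ((x \\ c) \\ c)
    double-\\-inflationary x = \\-intro (cyclic x (x \\ c) (proj₁ (\\-max x c)))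

    \\-triple : ∀ x → (((x \\ c) \\ c) \\ c) ≡ (x \\ c)
    \\-triple x = antisym (\\-antitoneˡ (double-\\-inflationary x)) (double-\\-inflationary (x \\ c))

    \\-image⊆Lγ : ∀ x → Lγ 𝐋 c (x \\ c)
    \\-image⊆Lγ x = x \\ c , sym (\\-triple x)

    Lγ-inf : ∀ S → (∀ y → S y → Lγ 𝐋 c y) → Σ[ i ∈ L ] IsInfIn (Lγ 𝐋 c) S i
    Lγ-inf S S⊆Lγ = ⋁ Z \\ c , \\-image⊆Lγ (⋁ Z) , lower , greatest
      where
        Z : Subset L
        Z z = S (z \\ c)

        -- every y ∈ S is z \\ c for z = w \\ c, where y = (w \\ c) \\ c
        lower : IsLowerBound S (⋁ Z \\ c)
        lower y Sy with S⊆Lγ y Sy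
        ... | w , refl = \\-antitoneˡ (join-upper (⋁-sup Z) (w \\ c) Sy)

        greatest : ∀ l → Lγ 𝐋 c l → IsLowerBound S l → l ≤ (⋁ Z \\ c)
        greatest l _ l-lower = \\-join-greatest (⋁-sup Z) (λ z Sz\\c → l-lower (z \\ c) Sz\\c)

    Lγ-complete : IsCompleteLatticeIn (Lγ 𝐋 c)
    Lγ-complete = IsCompleteLatticeIn-fromInfs _≤_ (Lγ 𝐋 c) Lγ-inf

module JoinCompletion {L : Set} {𝐋 : CompleteResiduatedLattice L}
    (𝐏 : ResiduatedSubPomonoid 𝐋) (join-completion : IsJoinCompletion 𝐏) where
  open CompleteResiduatedLattice 𝐋
  open ResiduatedSubPomonoid 𝐏
  open ResiduatedLatticeProperties 𝐋
  open CyclicElement 𝐋 using (IsCyclic)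

  module _ (x : L) where
    Basis : Subset L
    Basis = proj₁ (join-completion x)

    Basis⊆P : ∀ p → Basis p → InP p
    Basis⊆P = proj₁ (proj₂ (join-completion x))

    Basis-join : IsJoin Basis x
    Basis-join = proj₂ (proj₂ (join-completion x))

  \\P≡\\ : ∀ {a b} → InP a → InP b → (a \\P b) ≡ (a \\ b)
  \\P≡\\ {a} {b} Pa Pb = antisym (\\-intro (proj₂ (proj₁ a\\Pb-max))) a\\b≤a\\Pb
    where
      a\\Pb-max = \\P-max Pa Pb
      a\\b≤a\\Pb = join-least (Basis-join (a \\ b)) λ p Bp →
        proj₂ a\\Pb-max p (Basis⊆P _ p Bp , \\-elim (join-upper (Basis-join (a \\ b)) p Bp))

  //P≡// : ∀ {a b} → InP a → InP b → (b //P a) ≡ (b // a)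
  //P≡// {a} {b} Pa Pb = antisym (//-intro (proj₂ (proj₁ b//Pa-max))) b//a≤b//Pa
    where
      b//Pa-max = //P-max Pa Pb
      b//a≤b//Pa = join-least (Basis-join (b // a)) λ p Bp →
        proj₂ b//Pa-max p (Basis⊆P _ p Bp , //-elim (join-upper (Basis-join (b // a)) p Bp))

  \\-closed : ∀ {a b} → InP a → InP b → InP (a \\ b)
  \\-closed Pa Pb = subst InP (\\P≡\\ Pa Pb) (proj₁ (proj₁ (\\P-max Pa Pb)))

  IsCyclic-fromP : ∀ {d} → InP d → (∀ x → InP x → (d //P x) ≡ (x \\P d)) → IsCyclic d
  IsCyclic-fromP {d} Pd cyclicP x y xy≤d =
    //-elim (//-join-greatest (Basis-join x) λ s Bs →
      join-least (Basis-join y) λ t Bt →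
        swapP (Basis⊆P x s Bs) (Basis⊆P y t Bt)
          (≤-trans (·-mono (join-upper (Basis-join x) s Bs) (join-upper (Basis-join y) t Bt)) xy≤d))
    where
      \\≡// : ∀ {s} → InP s → (s \\ d) ≡ (d // s)
      \\≡// Ps = trans (sym (\\P≡\\ Ps Pd)) (trans (sym (cyclicP _ Ps)) (//P≡// Ps Pd))

      swapP : ∀ {s t} → InP s → InP t → (s · t) ≤ d → t ≤ (d // s)
      swapP {t = t} Ps _ st≤d = subst (t ≤_) (\\≡// Ps) (\\-intro st≤d)

module CyclicDualizing {L : Set} {𝐋 : CompleteResiduatedLattice L}
    (𝐏 : ResiduatedSubPomonoid 𝐋) (join-completion : IsJoinCompletion 𝐏)
    (d : L) (dualizing : IsCyclicDualizing 𝐏 d) where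
  open CompleteResiduatedLattice 𝐋
  open ResiduatedSubPomonoid 𝐏
  open ResiduatedLatticeProperties 𝐋
  open JoinCompletion 𝐏 join-completion
  open CyclicElement 𝐋 d using (\\-image⊆Lγ)

  Pd : InP d
  Pd = proj₁ dualizing

  \\P\\P-involutive : ∀ x → InP x → ((x \\P d) \\P d) ≡ x
  \\P\\P-involutive = proj₂ (proj₂ dualizing)

  d-cyclic : CyclicElement.IsCyclic 𝐋 d
  d-cyclic = IsCyclic-fromP Pd (proj₁ (proj₂ dualizing))

  P⊆Pγ : ∀ x → InP x → Pγ 𝐏 d x
  P⊆Pγ x Px = x , Px , sym (\\P\\P-involutive x Px)

  Pγ⊆Lγ : ∀ y → Pγ 𝐏 d y → Lγ 𝐋 d y
  Pγ⊆Lγ _ (x , Px , refl) = x , trans (cong (_\\P d) (\\P≡\\ Px Pd)) (\\P≡\\ (\\-closed Px Pd) Pd)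

  Lγ-join-dense : ∀ y → Lγ 𝐋 d y →
    Σ[ S ∈ Subset L ] ((∀ x → S x → Pγ 𝐏 d x) × IsSupIn (Lγ 𝐋 d) S y)
  Lγ-join-dense y Lγy = Below , (λ _ → proj₁) , Lγy , (λ _ → proj₂) , least
    where
      Below : Subset L
      Below x = Pγ 𝐏 d x × x ≤ y

      least : ∀ u → Lγ 𝐋 d u → IsUpperBound Below u → y ≤ u
      least u _ u-upper = join-least (Basis-join y) λ p Bp →
        u-upper p (P⊆Pγ p (Basis⊆P y p Bp) , join-upper (Basis-join y) p Bp)

  -- y = (w \\ d) \\ d is the meet of the r \\ d, r ranging over a basis of w \\ d, and r \\ d ∈ P
  Lγ-meet-dense : ∀ y → Lγ 𝐋 d y →
    Σ[ T ∈ Subset L ] ((∀ x → T x → Pγ 𝐏 d x) × IsInfIn (Lγ 𝐋 d) T y)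
  Lγ-meet-dense y Lγy@(w , refl) = Above , (λ _ → proj₁) , Lγy , (λ _ → proj₂) , greatest
    where
      Above : Subset L
      Above x = Pγ 𝐏 d x × y ≤ x

      greatest : ∀ l → Lγ 𝐋 d l → IsLowerBound Above l → l ≤ y
      greatest l _ l-lower = \\-join-greatest (Basis-join (w \\ d)) λ r Br →
        l-lower (r \\ d)
          (P⊆Pγ (r \\ d) (\\-closed (Basis⊆P _ r Br) Pd)
          , \\-antitoneˡ (join-upper (Basis-join (w \\ d)) r Br))

theorem4p4 : {L : Set} (𝐋 : CompleteResiduatedLattice L) (𝐏 : ResiduatedSubPomonoid 𝐋) →
    IsJoinCompletion 𝐏 →
    (d : L) → IsCyclicDualizing 𝐏 d →
    let open CompleteResiduatedLattice 𝐋 in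
    ((∀ y → Pγ 𝐏 d y → Lγ 𝐋 d y) ×
     IsCompleteLatticeIn (Lγ 𝐋 d) ×
     (∀ y → Lγ 𝐋 d y →
        (Σ[ S ∈ Subset L ] ((∀ x → S x → Pγ 𝐏 d x) × IsSupIn (Lγ 𝐋 d) S y)) ×
        (Σ[ T ∈ Subset L ] ((∀ x → T x → Pγ 𝐏 d x) × IsInfIn (Lγ 𝐋 d) T y))))
theorem4p4 𝐋 𝐏 join-completion d dualizing =
  Pγ⊆Lγ , CyclicElement.Lγ-complete 𝐋 d d-cyclic , λ y Lγy → Lγ-join-dense y Lγy , Lγ-meet-dense y Lγy
  where open CyclicDualizing 𝐏 join-completion d dualizing
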